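{- Let $(A,\leq,{}',0,1)$ be a finite orthomodular poset, $(T,R)$ a time frame and $X,Y,Z\in\{P,F,H,G\}$. Then: (i) Put $i:=1$ if $Z\in\{H,G\}$ and $i:=2$ otherwise, and assume $X(\varphi(x))\odot Y(q)\leq_iZ(\varphi(x\odot q))$ for all $x\in(2^A\setminus\{\emptyset\})^T$ and all $q\in A^T$. Then $X(\varphi(p\rightarrow q))\sqsubseteq Y(p)\rightarrow Z(q)$ for all $p,q\in A^T$. (ii) Put $i:=1$ if $X\in\{H,G\}$ and $i:=2$ otherwise, and assume $X(\varphi(p\rightarrow x))\leq_iY(p)\rightarrow Z(\varphi(x))$ for all $p\in A^T$ and all $x\in(2^A\setminus\{\emptyset\})^T$. Then $X(p)\odot Y(q)\sqsubseteq Z(\varphi(p\odot q))$ for all $p,q\in A^T$.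
   Context: An orthomodular poset is a bounded poset $(A,\leq,0,1)$ with a unary operation ${}'$ that is an antitone involution ($a\leq b\Rightarrow b'\leq a'$, $a''=a$) and a complementation ($a\vee a'=1$, $a\wedge a'=0$), such that (i) if $x\leq y'$ then $x\vee y$ exists, and (ii) if $x\leq y$ then $y=x\vee(y\wedge x')$. For $B\subseteq A$: $L(B)$, $U(B)$ are the sets of lower and upper bounds of $B$; $\operatorname{Max}B$, $\operatorname{Min}B$ the sets of maximal and minimal elements. For $a\in A$, $B\subseteq A$: $a\vee B=\{a\vee b\mid b\in B\}$, $B\wedge a=\{b\wedge a\mid b\in B\}$. Connectives: for $a,b\in A$, $a\odot b:=\operatorname{Min}U(\{a,b'\})\wedge b$ and $a\rightarrow b:=a'\vee\operatorname{Max}L(\{a,b\})$ (always defined, nonempty subsets of $A$); for nonempty $B,C\subseteq A$, $B\odot C=\bigcup\{b\odot c\mid b\in B,c\in C\}$, $B\rightarrow C=\bigcup\{b\rightarrow c\mid b\in B,c\in C\}$; for $x,y\in(2^A\setminus\{\emptyset\})^T$, $(x\odot y)(t)=x(t)\odot y(t)$, $(x\rightarrow y)(t)=x(t)\rightarrow y(t)$; elements $a$ are identified with $\{a\}$ and $p\in A^T$ with $t\mapsto\{p(t)\}$. A time frame is $(T,R)$ with $T\neq\emptyset$, $R\subseteq T^2$ serial (each $s$ has some $r\mathrel Rs$ and some $s\mathrel Rt$). Tense operators: for nonempty $B\subseteq A^T$ (with $q\in A^T$ identified with $\{q\}$) and $s\in T$: $P(B)(s)=\operatorname{Min}U(\{q(t)\mid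 q\in B,t\mathrel Rs\})$, $F(B)(s)=\operatorname{Min}U(\{q(t)\mid q\in B,s\mathrel Rt\})$, $H(B)(s)=\operatorname{Max}L(\{q(t)\mid q\in B,t\mathrel Rs\})$, $G(B)(s)=\operatorname{Max}L(\{q(t)\mid q\in B,s\mathrel Rt\})$. $\varphi(x)=\{q\in A^T\mid q(t)\in x(t)\ \forall t\}$ for $x\in(2^A\setminus\{\emptyset\})^T$. For nonempty $B,C\subseteq A$: $B\leq_1C$ iff $\forall b\in B\,\exists c\in C: b\leq c$; $B\leq_2C$ iff $\forall c\in C\,\exists b\in B: b\leq c$; $B\sqsubseteq C$ iff $\exists b\in B,c\in C: b\leq c$. These relations are extended to $(2^A\setminus\{\emptyset\})^T$ pointwise (for all $t\in T$). -}

module Defs where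

open import Level using (0ℓ)
open import Data.Nat using (ℕ)
open import Data.Fin using (Fin)
open import Data.Product using (Σ; ∃; _×_; _,_)
open import Data.Sum using (_⊎_)
open import Function.Bundles using (_↔_)
open import Relation.Binary.PropositionalEquality using (_≡_)

module _ {A : Set} (_≤_ : A → A → Set) where
  IsJoin : A → A → A → Set
  IsJoin x y z = (x ≤ z) × (y ≤ z) × (∀ w → x ≤ w → y ≤ w → z ≤ w)

  IsMeet : A → A → A → Set
  IsMeet x y z = (z ≤ x) × (z ≤ y) × (∀ w → w ≤ x → w ≤ y → w ≤ z)

record OMP : Set₁ where
  infix 4 _≤_
  infix 10 _′
  field
    Carrier    : Set
    _≤_        : Carrier → Carrier → Set
    ≤-refl     : ∀ {a} → a ≤ a
    ≤-antisym  : ∀ {a b} → a ≤ b → b ≤ a → a ≡ b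
    ≤-trans    : ∀ {a b c} → a ≤ b → b ≤ c → a ≤ c
    𝟎          : Carrier
    𝟏          : Carrier
    𝟎-least    : ∀ a → 𝟎 ≤ a
    𝟏-greatest : ∀ a → a ≤ 𝟏
    _′         : Carrier → Carrier
    ′-antitone : ∀ {a b} → a ≤ b → b ′ ≤ a ′
    ′-involutive : ∀ a → a ′ ′ ≡ a
    compl-join : ∀ a → IsJoin _≤_ a (a ′) 𝟏
    compl-meet : ∀ a → IsMeet _≤_ a (a ′) 𝟎
    orth-join  : ∀ x y → x ≤ y ′ → ∃ λ z → IsJoin _≤_ x y z
    orthomodular : ∀ x y → x ≤ y → ∀ m → IsMeet _≤_ y (x ′) m → IsJoin _≤_ x m y

Finite : OMP → Set
Finite O = Σ ℕ λ n → OMP.Carrier O ↔ Fin n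

record TimeFrame : Set₁ where
  field
    T        : Set
    R        : T → T → Set
    inhabited : T
    serial-past   : ∀ s → ∃ λ r → R r s
    serial-future : ∀ s → ∃ λ t → R s t

data Op : Set where
  P F H G : Op

data Idx : Set where
  one two : Idx

idx : Op → Idx
idx P = two
idx F = two
idx H = one
idx G = one

module Theory (O : OMP) (TF : TimeFrame) where
  open OMP O
  open TimeFrame TF public using (T; R)

  A : Set
  A = Carrier

  Sub : Set → Set₁
  Sub X = X → Set

  ⟦_⟧ : A → Sub A
  ⟦ a ⟧ c = c ≡ a

  pair : A → A → Sub A
  pair a b c = (c ≡ a) ⊎ (c ≡ b)

  L U Max Min : Sub A → Sub A
  L B a = ∀ b → B b → a ≤ b
  U B a = ∀ b → B b → b ≤ a
  Max B a = B a × (∀ b → B b → a ≤ b → b ≡ a)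
  Min B a = B a × (∀ b → B b → b ≤ a → b ≡ a)

  _∨ˢ_ : A → Sub A → Sub A
  (a ∨ˢ B) z = ∃ λ b → B b × IsJoin _≤_ a b z

  _∧ˢ_ : Sub A → A → Sub A
  (B ∧ˢ a) z = ∃ λ b → B b × IsMeet _≤_ b a z

  _⊙_ : A → A → Sub A
  a ⊙ b = Min (U (pair a (b ′))) ∧ˢ b

  _⇒_ : A → A → Sub A
  a ⇒ b = (a ′) ∨ˢ Max (L (pair a b))

  _⊙ˢ_ : Sub A → Sub A → Sub A
  (B ⊙ˢ C) z = ∃ λ b → ∃ λ c → B b × C c × (b ⊙ c) z

  _⇒ˢ_ : Sub A → Sub A → Sub A
  (B ⇒ˢ C) z = ∃ λ b → ∃ λ c → B b × C c × (b ⇒ c) z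

  SF : Set₁
  SF = T → Sub A

  _⊙ᵀ_ : SF → SF → SF
  (x ⊙ᵀ y) t = x t ⊙ˢ y t

  _⇒ᵀ_ : SF → SF → SF
  (x ⇒ᵀ y) t = x t ⇒ˢ y t

  -- p ∈ A^T identified with t ↦ {p(t)}
  ↑ : (T → A) → SF
  ↑ p t = ⟦ p t ⟧

  NonEmptyValued : SF → Set
  NonEmptyValued x = ∀ t → ∃ λ a → x t a

  φ : SF → Sub (T → A)
  φ x q = ∀ t → x t (q t)

  -- q ∈ A^T identified with {q}
  single : (T → A) → Sub (T → A)
  single q r = r ≡ q

  past future : Sub (T → A) → T → Sub A
  past B s a = ∃ λ q → B q × ∃ λ t → R t s × q t ≡ a
  future B s a = ∃ λ q → B q × ∃ λ t → R s t × q t ≡ a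

  𝐏 𝐅 𝐇 𝐆 : Sub (T → A) → SF
  𝐏 B s = Min (U (past B s))
  𝐅 B s = Min (U (future B s))
  𝐇 B s = Max (L (past B s))
  𝐆 B s = Max (L (future B s))

  op : Op → Sub (T → A) → SF
  op P = 𝐏
  op F = 𝐅
  op H = 𝐇
  op G = 𝐆

  _≤₁_ _≤₂_ _⊑_ : Sub A → Sub A → Set
  B ≤₁ C = ∀ b → B b → ∃ λ c → C c × b ≤ c
  B ≤₂ C = ∀ c → C c → ∃ λ b → B b × b ≤ c
  B ⊑ C = ∃ λ b → ∃ λ c → B b × C c × b ≤ c

  rel : Idx → Sub A → Sub A → Set
  rel one = _≤₁_
  rel two = _≤₂_

  _≤[_]ᵀ_ : SF → Idx → SF → Set
  x ≤[ i ]ᵀ y = ∀ t → rel i (x t) (y t)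

  _⊑ᵀ_ : SF → SF → Set
  x ⊑ᵀ y = ∀ t → x t ⊑ y t

module Submission where

-- On a finite orthomodular poset (with excluded middle) every Min U(B) and Max L(B) is
-- nonempty and every element of a set lies below a maximal and above a minimal one.  This
-- makes the connectives adjoint on elements (some w ∈ u ⊙ b lies below c iff some
-- v ∈ b ⇒ c lies above u), with counit (a ⇒ b) ⊙ a ≤ b and unit a ≤ b ⇒ (a ⊙ b), and it
-- makes the tense operators monotone for ≤₁ and ≤₂.  For (i), instantiate the hypothesis at
-- x = p ⇒ q: by the counit every selection of (p ⇒ q) ⊙ p lies below q, so
-- X(φ(p ⇒ q)) ⊙ Y(p) ≤ᵢ Z(q); between nonempty sets this yields ⊑, and the adjunction moves
-- Y(p) to the right.  Part (ii) is dual, using the unit.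

open import Defs
open import Level using (0ℓ)
open import Data.Nat using (ℕ)
open import Data.Fin using (Fin)
open import Data.Fin.Induction using (spo-noetherian)
open import Data.Product using (∃; _×_; _,_; proj₁; proj₂)
open import Data.Sum using (inj₁; inj₂)
open import Function using (flip)
open import Function.Bundles using (_↔_; Inverse)
open import Axiom.ExcludedMiddle using (ExcludedMiddle)
open import Induction.WellFounded using (WellFounded; Acc; acc; module Subrelation)
open import Relation.Binary.Core using (Rel)
open import Relation.Binary.Structures using (IsPartialOrder)
open import Relation.Binary.PropositionalEquality using (_≡_; refl; sym; subst; isEquivalence)
open import Relation.Nullary.Decidable using (yes; no; decidable-stable)
import Relation.Binary.Construct.On as On
import Relation.Binary.Construct.NonStrictToStrict as NonStrictToStrict
import Relation.Binary.Construct.Flip.EqAndOrd as Flip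

module FinitePoset (em : ExcludedMiddle 0ℓ) {A : Set} {_≤_ : Rel A 0ℓ}
         (isPO : IsPartialOrder _≡_ _≤_) {n : ℕ} (A↔Fin : A ↔ Fin n) where
  open IsPartialOrder isPO using (trans) renaming (refl to ≤-refl)
  open Inverse A↔Fin using (to; from; strictlyInverseʳ)
  open NonStrictToStrict _≡_ _≤_ using (_<_; <-isStrictPartialOrder)

  <-noetherian : WellFounded (flip _<_)
  <-noetherian = Subrelation.wellFounded <⇒<-via-Fin
    (On.wellFounded to (spo-noetherian (On.isStrictPartialOrder from (<-isStrictPartialOrder isPO))))
    where
    <⇒<-via-Fin : ∀ {a b} → b < a → from (to b) < from (to a)
    <⇒<-via-Fin {a} {b} rewrite strictlyInverseʳ a | strictlyInverseʳ b = λ b<a → b<a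

  maximal-above : (B : A → Set) → ∀ {a} → B a →
                  ∃ λ m → (B m × (∀ b → B b → m ≤ b → b ≡ m)) × a ≤ m
  maximal-above B = climb (<-noetherian _)
    where
    climb : ∀ {a} → Acc (flip _<_) a → B a →
            ∃ λ m → (B m × (∀ b → B b → m ≤ b → b ≡ m)) × a ≤ m
    climb {a} (acc above) Ba with em {∃ λ b → B b × a < b}
    ... | yes (b , Bb , a<b) =
          let m , m-maximal , b≤m = climb (above a<b) Bb in m , m-maximal , trans (proj₁ a<b) b≤m
    ... | no ∄b = a , (Ba , a-maximal) , ≤-refl
      where
      a-maximal : ∀ b → B b → a ≤ b → b ≡ a
      a-maximal b Bb a≤b =
        decidable-stable em λ b≢a → ∄b (b , Bb , a≤b , λ a≡b → b≢a (sym a≡b))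

module OrthomodularPosetProperties (O : OMP) where
  open OMP O

  ≤-isPartialOrder : IsPartialOrder _≡_ _≤_
  ≤-isPartialOrder = record
    { isPreorder = record
      { isEquivalence = isEquivalence
      ; reflexive     = λ { refl → ≤-refl }
      ; trans         = ≤-trans
      }
    ; antisym = ≤-antisym
    }

  x≤y′⇒y≤x′ : ∀ {x y} → x ≤ y ′ → y ≤ x ′
  x≤y′⇒y≤x′ {x} {y} x≤y′ = subst (_≤ x ′) (′-involutive y) (′-antitone x≤y′)

  x′≤y⇒y′≤x : ∀ {x y} → x ′ ≤ y → y ′ ≤ x
  x′≤y⇒y′≤x {x} {y} x′≤y = subst (y ′ ≤_) (′-involutive x) (′-antitone x′≤y)

  join′⇒meet : ∀ {x y z} → IsJoin _≤_ (x ′) (y ′) z → IsMeet _≤_ x y (z ′)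
  join′⇒meet (x′≤z , y′≤z , z-least) =
    x′≤y⇒y′≤x x′≤z , x′≤y⇒y′≤x y′≤z ,
    λ w w≤x w≤y → x≤y′⇒y≤x′ (z-least (w ′) (′-antitone w≤x) (′-antitone w≤y))

  orth-meet : ∀ x y → x ′ ≤ y → ∃ λ z → IsMeet _≤_ x y z
  orth-meet x y x′≤y =
    let z , z-join = orth-join (x ′) (y ′) (subst (x ′ ≤_) (sym (′-involutive y)) x′≤y)
    in z ′ , join′⇒meet z-join

  orthomodular′ : ∀ {b m w} → b ′ ≤ m → IsMeet _≤_ m b w → IsJoin _≤_ (b ′) w m
  orthomodular′ {b} {m} {w} b′≤m w-meet =
    orthomodular (b ′) m b′≤m w (subst (λ y → IsMeet _≤_ m y w) (sym (′-involutive b)) w-meet)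

  -- With k = g ∧ d′, orthomodularity gives g = d ∨ k; but k ≤ a and k ≤ d′ force a′ ∨ d ≤ k′,
  -- so k ≤ g ≤ a′ ∨ d ≤ k′ and k = 0.
  [a′∨d]∧a≤d : ∀ {a d e g} → d ≤ a → IsJoin _≤_ (a ′) d e → IsMeet _≤_ e a g → g ≤ d
  [a′∨d]∧a≤d {d = d} {e} {g} d≤a (_ , d≤e , e-least) (g≤e , g≤a , g-greatest) =
    below-d (orth-meet g (d ′) (′-antitone d≤g))
    where
    d≤g : d ≤ g
    d≤g = g-greatest d d≤e d≤a
    below-d : (∃ λ k → IsMeet _≤_ g (d ′) k) → g ≤ d
    below-d (k , k-meet@(k≤g , k≤d′ , _)) = g-least d ≤-refl (≤-trans k≤0 (𝟎-least d))
      where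
      g-least : ∀ x → d ≤ x → k ≤ x → g ≤ x
      g-least = proj₂ (proj₂ (orthomodular d g d≤g k k-meet))
      e≤k′ : e ≤ k ′
      e≤k′ = e-least (k ′) (′-antitone (≤-trans k≤g g≤a)) (x≤y′⇒y≤x′ k≤d′)
      k≤0 : k ≤ 𝟎
      k≤0 = proj₂ (proj₂ (compl-meet k)) k ≤-refl (≤-trans (≤-trans k≤g g≤e) e≤k′)

module TenseLogic (em : ExcludedMiddle 0ℓ) (O : OMP) (fin : Finite O) (TF : TimeFrame) where
  open OMP O
  open Theory O TF
  open OrthomodularPosetProperties O

  open FinitePoset em ≤-isPartialOrder (proj₂ fin) using (maximal-above)
  open FinitePoset em (Flip.isPartialOrder ≤-isPartialOrder) (proj₂ fin)
    using () renaming (maximal-above to minimal-below)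

  U-pair⁺ : ∀ {a b m} → a ≤ m → b ≤ m → U (pair a b) m
  U-pair⁺ a≤m b≤m _ (inj₁ refl) = a≤m
  U-pair⁺ a≤m b≤m _ (inj₂ refl) = b≤m

  U-pair⁻₁ : ∀ {a b m} → U (pair a b) m → a ≤ m
  U-pair⁻₁ {a} m∈U = m∈U a (inj₁ refl)

  U-pair⁻₂ : ∀ {a b m} → U (pair a b) m → b ≤ m
  U-pair⁻₂ {b = b} m∈U = m∈U b (inj₂ refl)

  L-pair⁺ : ∀ {a b m} → m ≤ a → m ≤ b → L (pair a b) m
  L-pair⁺ m≤a m≤b _ (inj₁ refl) = m≤a
  L-pair⁺ m≤a m≤b _ (inj₂ refl) = m≤b

  L-pair⁻₁ : ∀ {a b m} → L (pair a b) m → m ≤ a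
  L-pair⁻₁ {a} m∈L = m∈L a (inj₁ refl)

  L-pair⁻₂ : ∀ {a b m} → L (pair a b) m → m ≤ b
  L-pair⁻₂ {b = b} m∈L = m∈L b (inj₂ refl)

  MinU-pair-≤ : ∀ {a b m} → Min (U (pair a b)) m → b ≤ a → m ≡ a
  MinU-pair-≤ (m∈U , m-minimal) b≤a = sym (m-minimal _ (U-pair⁺ ≤-refl b≤a) (U-pair⁻₁ m∈U))

  MaxL-pair-≤ : ∀ {a b d} → Max (L (pair a b)) d → b ≤ a → d ≡ b
  MaxL-pair-≤ (d∈L , d-maximal) b≤a = sym (d-maximal _ (L-pair⁺ b≤a ≤-refl) (L-pair⁻₂ d∈L))

  ⇒-⊙-counit : ∀ {a b e g} → (a ⇒ b) e → (e ⊙ a) g → g ≤ b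
  ⇒-⊙-counit {a} {e = e} {g} (d , (d∈L , _) , e-join) (m , m-minimal , g-meet) =
    ≤-trans ([a′∨d]∧a≤d (L-pair⁻₁ d∈L) e-join g-meet′) (L-pair⁻₂ d∈L)
    where
    g-meet′ : IsMeet _≤_ e a g
    g-meet′ = subst (λ z → IsMeet _≤_ z _ _) (MinU-pair-≤ m-minimal (proj₁ e-join)) g-meet

  ⊙-⇒-unit : ∀ {a b c h} → (a ⊙ b) c → (b ⇒ c) h → a ≤ h
  ⊙-⇒-unit {b = b} {c} {h} (m , (m∈U , _) , c-meet) (d , d-maximal , (b′≤h , d≤h , _)) =
    ≤-trans (U-pair⁻₁ m∈U) (m-least h b′≤h (subst (_≤ h) d≡c d≤h))
    where
    d≡c : d ≡ c
    d≡c = MaxL-pair-≤ d-maximal (proj₁ (proj₂ c-meet))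
    m-least : ∀ x → b ′ ≤ x → c ≤ x → m ≤ x
    m-least = proj₂ (proj₂ (orthomodular′ (U-pair⁻₂ m∈U) c-meet))

  -- v = b′ ∨ d for a maximal d ∈ L{b, c} above w; then u ≤ m = b′ ∨ w ≤ v.
  residuate-⇒ : ∀ {u b w c} → (u ⊙ b) w → w ≤ c → ∃ λ v → (b ⇒ c) v × u ≤ v
  residuate-⇒ {b = b} {c = c} (m , (m∈U , _) , w-meet@(_ , w≤b , _)) w≤c =
    let d , d-maximal , w≤d = maximal-above (L (pair b c)) (L-pair⁺ w≤b w≤c)
        v , v-join          = orth-join (b ′) d (′-antitone (L-pair⁻₁ (proj₁ d-maximal)))
        m-least             = proj₂ (proj₂ (orthomodular′ (U-pair⁻₂ m∈U) w-meet))
        b′≤v , d≤v , _      = v-join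
    in v , (d , d-maximal , v-join) , ≤-trans (U-pair⁻₁ m∈U) (m-least v b′≤v (≤-trans w≤d d≤v))

  -- w = m ∧ b for a minimal m ∈ U{u, b′} below v; then w ≤ v ∧ b ≤ d ≤ c.
  residuate-⊙ : ∀ {u v b c} → u ≤ v → (b ⇒ c) v → ∃ λ w → (u ⊙ b) w × w ≤ c
  residuate-⊙ {u} {v} {b} u≤v (d , (d∈L , _) , v-join) =
    let m , m-minimal , m≤v = minimal-below (U (pair u (b ′))) (U-pair⁺ u≤v (proj₁ v-join))
        w , w-meet          = orth-meet m b (x′≤y⇒y′≤x (U-pair⁻₂ (proj₁ m-minimal)))
        n , n-meet          = orth-meet v b (x′≤y⇒y′≤x (proj₁ v-join))
        w≤m , w≤b , _       = w-meet
        _ , _ , n-greatest  = n-meet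
    in w , (m , m-minimal , w-meet) ,
       ≤-trans (n-greatest w (≤-trans w≤m m≤v) w≤b) (≤-trans ([a′∨d]∧a≤d (L-pair⁻₁ d∈L) v-join n-meet) (L-pair⁻₂ d∈L))

  MinU-nonempty : (B : Sub A) → ∃ (Min (U B))
  MinU-nonempty B =
    let m , m-minimal , _ = minimal-below (U B) (λ b _ → 𝟏-greatest b) in m , m-minimal

  MaxL-nonempty : (B : Sub A) → ∃ (Max (L B))
  MaxL-nonempty B =
    let m , m-maximal , _ = maximal-above (L B) (λ b _ → 𝟎-least b) in m , m-maximal

  op-nonempty : ∀ Z B s → ∃ (op Z B s)
  op-nonempty P B s = MinU-nonempty _
  op-nonempty F B s = MinU-nonempty _
  op-nonempty H B s = MaxL-nonempty _
  op-nonempty G B s = MaxL-nonempty _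

  ⊙-nonempty : ∀ a b → ∃ (a ⊙ b)
  ⊙-nonempty a b =
    let m , m-minimal = MinU-nonempty (pair a (b ′))
        w , w-meet    = orth-meet m b (x′≤y⇒y′≤x (U-pair⁻₂ (proj₁ m-minimal)))
    in w , m , m-minimal , w-meet

  ⇒-nonempty : ∀ a b → ∃ (a ⇒ b)
  ⇒-nonempty a b =
    let d , d-maximal = MaxL-nonempty (pair a b)
        v , v-join    = orth-join (a ′) d (′-antitone (L-pair⁻₁ (proj₁ d-maximal)))
    in v , d , d-maximal , v-join

  ⊙ˢ-nonempty : ∀ {B C} → ∃ B → ∃ C → ∃ (B ⊙ˢ C)
  ⊙ˢ-nonempty (b , b∈B) (c , c∈C) = let w , w∈b⊙c = ⊙-nonempty b c in w , b , c , b∈B , c∈C , w∈b⊙c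

  ⇒ˢ-nonempty : ∀ {B C} → ∃ B → ∃ C → ∃ (B ⇒ˢ C)
  ⇒ˢ-nonempty (b , b∈B) (c , c∈C) = let v , v∈b⇒c = ⇒-nonempty b c in v , b , c , b∈B , c∈C , v∈b⇒c

  φ-nonempty : ∀ {x} → NonEmptyValued x → ∃ (φ x)
  φ-nonempty x-nonempty = (λ t → proj₁ (x-nonempty t)) , (λ t → proj₂ (x-nonempty t))

  ⇒ˢ-⊙ˢ-counit : ∀ {a b g} → ((⟦ a ⟧ ⇒ˢ ⟦ b ⟧) ⊙ˢ ⟦ a ⟧) g → g ≤ b
  ⇒ˢ-⊙ˢ-counit (_ , _ , (_ , _ , refl , refl , e∈a⇒b) , refl , g∈e⊙a) = ⇒-⊙-counit e∈a⇒b g∈e⊙a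

  ⊙ˢ-⇒ˢ-unit : ∀ {a b h} → (⟦ b ⟧ ⇒ˢ (⟦ a ⟧ ⊙ˢ ⟦ b ⟧)) h → a ≤ h
  ⊙ˢ-⇒ˢ-unit (_ , _ , refl , (_ , _ , refl , refl , c∈a⊙b) , h∈b⇒c) = ⊙-⇒-unit c∈a⊙b h∈b⇒c

  residuate-⊑-⇒ˢ : ∀ {B C D} → (B ⊙ˢ C) ⊑ D → B ⊑ (C ⇒ˢ D)
  residuate-⊑-⇒ˢ (w , d , (b , c , b∈B , c∈C , w∈b⊙c) , d∈D , w≤d) =
    let v , v∈c⇒d , b≤v = residuate-⇒ w∈b⊙c w≤d in b , v , b∈B , (c , d , c∈C , d∈D , v∈c⇒d) , b≤v

  residuate-⊑-⊙ˢ : ∀ {B C D} → B ⊑ (C ⇒ˢ D) → (B ⊙ˢ C) ⊑ D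
  residuate-⊑-⊙ˢ (b , v , b∈B , (c , d , c∈C , d∈D , v∈c⇒d) , b≤v) =
    let w , w∈b⊙c , w≤d = residuate-⊙ b≤v v∈c⇒d in w , d , (b , c , b∈B , c∈C , w∈b⊙c) , d∈D , w≤d

  rel-trans : ∀ i {B C D} → rel i B C → rel i C D → rel i B D
  rel-trans one B≤C C≤D b b∈B =
    let c , c∈C , b≤c = B≤C b b∈B ; d , d∈D , c≤d = C≤D c c∈C in d , d∈D , ≤-trans b≤c c≤d
  rel-trans two B≤C C≤D d d∈D =
    let c , c∈C , c≤d = C≤D d d∈D ; b , b∈B , b≤c = B≤C c c∈C in b , b∈B , ≤-trans b≤c c≤d

  rel⇒⊑ : ∀ i {B C} → rel i B C → ∃ B → ∃ C → B ⊑ C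
  rel⇒⊑ one B≤C (b , b∈B) _ = let c , c∈C , b≤c = B≤C b b∈B in b , c , b∈B , c∈C , b≤c
  rel⇒⊑ two B≤C _ (c , c∈C) = let b , b∈B , b≤c = B≤C c c∈C in b , c , b∈B , c∈C , b≤c

  MinU-mono : ∀ {B C} → B ≤₁ C → Min (U B) ≤₂ Min (U C)
  MinU-mono {B} {C} B≤C m (m∈UC , _) = minimal-below (U B) λ b b∈B →
    let c , c∈C , b≤c = B≤C b b∈B in ≤-trans b≤c (m∈UC c c∈C)

  MaxL-mono : ∀ {B C} → B ≤₂ C → Max (L B) ≤₁ Max (L C)
  MaxL-mono {B} {C} B≤C m (m∈LB , _) = maximal-above (L C) λ c c∈C →
    let b , b∈B , b≤c = B≤C c c∈C in ≤-trans (m∈LB b b∈B) b≤c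

  -- past = image R and future = image (flip R), definitionally.
  image : (T → T → Set) → Sub (T → A) → T → Sub A
  image S B s a = ∃ λ q → B q × ∃ λ t → S t s × q t ≡ a

  _≤₁ᶠ_ _≤₂ᶠ_ : Sub (T → A) → Sub (T → A) → Set
  B ≤₁ᶠ C = ∀ g → B g → ∃ λ h → C h × (∀ t → g t ≤ h t)
  B ≤₂ᶠ C = ∀ h → C h → ∃ λ g → B g × (∀ t → g t ≤ h t)

  image-mono₁ : ∀ S {B C} → B ≤₁ᶠ C → ∀ s → image S B s ≤₁ image S C s
  image-mono₁ S B≤C s _ (g , g∈B , t , tSs , refl) =
    let h , h∈C , g≤h = B≤C g g∈B in h t , (h , h∈C , t , tSs , refl) , g≤h t

  image-mono₂ : ∀ S {B C} → B ≤₂ᶠ C → ∀ s → image S B s ≤₂ image S C s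
  image-mono₂ S B≤C s _ (h , h∈C , t , tSs , refl) =
    let g , g∈B , g≤h = B≤C h h∈C in g t , (g , g∈B , t , tSs , refl) , g≤h t

  op-mono : ∀ Z {B C} → B ≤₁ᶠ C → B ≤₂ᶠ C → op Z B ≤[ idx Z ]ᵀ op Z C
  op-mono P B≤₁C _ s = MinU-mono (image-mono₁ R B≤₁C s)
  op-mono F B≤₁C _ s = MinU-mono (image-mono₁ (flip R) B≤₁C s)
  op-mono H _ B≤₂C s = MaxL-mono (image-mono₂ R B≤₂C s)
  op-mono G _ B≤₂C s = MaxL-mono (image-mono₂ (flip R) B≤₂C s)

  op-mono-≤single : ∀ Z {B q} → ∃ B → (∀ g → B g → ∀ t → g t ≤ q t) →
                    op Z B ≤[ idx Z ]ᵀ op Z (single q)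
  op-mono-≤single Z {q = q} (g , g∈B) B≤q =
    op-mono Z (λ g g∈B → q , refl , B≤q g g∈B) (λ { _ refl → g , g∈B , B≤q g g∈B })

  op-mono-single≤ : ∀ Z {p B} → ∃ B → (∀ h → B h → ∀ t → p t ≤ h t) →
                    op Z (single p) ≤[ idx Z ]ᵀ op Z B
  op-mono-single≤ Z {p} (h , h∈B) p≤B =
    op-mono Z (λ { _ refl → h , h∈B , p≤B h h∈B }) (λ h h∈B → p , refl , p≤B h h∈B)

  ⇒-from-⊙-compatibility : (X Y Z : Op) →
    ((x : SF) → NonEmptyValued x → (q : T → A) →
      (op X (φ x) ⊙ᵀ op Y (single q)) ≤[ idx Z ]ᵀ op Z (φ (x ⊙ᵀ ↑ q))) →
    (p q : T → A) → op X (φ (↑ p ⇒ᵀ ↑ q)) ⊑ᵀ (op Y (single p) ⇒ᵀ op Z (single q))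
  ⇒-from-⊙-compatibility X Y Z compatible p q s =
    residuate-⊑-⇒ˢ (rel⇒⊑ (idx Z) X⊙Y≤Z (⊙ˢ-nonempty (op-nonempty X _ s) (op-nonempty Y _ s))
                                        (op-nonempty Z _ s))
    where
    p⇒q-nonempty : NonEmptyValued (↑ p ⇒ᵀ ↑ q)
    p⇒q-nonempty t = ⇒ˢ-nonempty (p t , refl) (q t , refl)
    X⊙Y≤Z : rel (idx Z) ((op X (φ (↑ p ⇒ᵀ ↑ q)) ⊙ᵀ op Y (single p)) s) (op Z (single q) s)
    X⊙Y≤Z = rel-trans (idx Z) (compatible (↑ p ⇒ᵀ ↑ q) p⇒q-nonempty p s)
      (op-mono-≤single Z (φ-nonempty λ t → ⊙ˢ-nonempty (p⇒q-nonempty t) (p t , refl))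
                         (λ g g∈φ t → ⇒ˢ-⊙ˢ-counit (g∈φ t)) s)

  ⊙-from-⇒-compatibility : (X Y Z : Op) →
    ((p : T → A) → (x : SF) → NonEmptyValued x →
      op X (φ (↑ p ⇒ᵀ x)) ≤[ idx X ]ᵀ (op Y (single p) ⇒ᵀ op Z (φ x))) →
    (p q : T → A) → (op X (single p) ⊙ᵀ op Y (single q)) ⊑ᵀ op Z (φ (↑ p ⊙ᵀ ↑ q))
  ⊙-from-⇒-compatibility X Y Z compatible p q s =
    residuate-⊑-⊙ˢ (rel⇒⊑ (idx X) X≤Y⇒Z (op-nonempty X _ s)
                          (⇒ˢ-nonempty (op-nonempty Y _ s) (op-nonempty Z _ s)))
    where
    p⊙q-nonempty : NonEmptyValued (↑ p ⊙ᵀ ↑ q)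
    p⊙q-nonempty t = ⊙ˢ-nonempty (p t , refl) (q t , refl)
    X≤Y⇒Z : rel (idx X) (op X (single p) s) ((op Y (single q) ⇒ᵀ op Z (φ (↑ p ⊙ᵀ ↑ q))) s)
    X≤Y⇒Z = rel-trans (idx X)
      (op-mono-single≤ X (φ-nonempty λ t → ⇒ˢ-nonempty (q t , refl) (p⊙q-nonempty t))
                         (λ h h∈φ t → ⊙ˢ-⇒ˢ-unit (h∈φ t)) s)
      (compatible q (↑ p ⊙ᵀ ↑ q) p⊙q-nonempty s)

theorem15 : ExcludedMiddle 0ℓ →
    (O : OMP) → Finite O → (TF : TimeFrame) → (X Y Z : Op) →
    let open Theory O TF in
    ( ((x : SF) → NonEmptyValued x → (q : T → A) →
          (op X (φ x) ⊙ᵀ op Y (single q)) ≤[ idx Z ]ᵀ op Z (φ (x ⊙ᵀ ↑ q)))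
      → (p q : T → A) →
          op X (φ (↑ p ⇒ᵀ ↑ q)) ⊑ᵀ (op Y (single p) ⇒ᵀ op Z (single q)) )
    ×
    ( ((p : T → A) → (x : SF) → NonEmptyValued x →
          op X (φ (↑ p ⇒ᵀ x)) ≤[ idx X ]ᵀ (op Y (single p) ⇒ᵀ op Z (φ x)))
      → (p q : T → A) →
          (op X (single p) ⊙ᵀ op Y (single q)) ⊑ᵀ op Z (φ (↑ p ⊙ᵀ ↑ q)) )
theorem15 em O fin TF X Y Z = ⇒-from-⊙-compatibility X Y Z , ⊙-from-⇒-compatibility X Y Z
  where open TenseLogic em O fin TF
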